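{- Let $u,v\ge 1$ be integers and let $z$ be an indeterminate. For every integer $n\ge 0$ and every $i=1,\dots,2^n$, \[ c_z^{(u,v)}(n,i)\cdot c_{\frac{v}{u}z^{ -1}}^{(u,v)}(n,2^n+1-i)=\frac{v}{u} \] in $\mathbb{Q}(z)$, where the second factor is a vertex of the tree with root $\frac{v}{uz}$.
   Context: For integers $u,v\ge 1$ and a root $r\in\mathbb{Q}(z)$ ($z$ an indeterminate), the $(u,v)$-Calkin–Wilf tree $\mathcal{T}^{(u,v)}(r)$ is the infinite binary tree with root $r$, whose vertices are elements of $\mathbb{Q}(z)$, in which every vertex $w$ has left child $w/(uw+1)$ and right child $w+v$. Rows are numbered from $0$ (row $0$ is the root), so row $n$ has $2^n$ vertices; $c_r^{(u,v)}(n,i)$ denotes the $i$-th vertex from the left in row $n$ of $\mathcal{T}^{(u,v)}(r)$ (the left and right children of the $k$-th vertex of row $n$ are the $(2k-1)$-th and $2k$-th vertices of row $n+1$). -}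

module Defs where

open import Data.Nat using (ℕ; zero; suc; ⌊_/2⌋)
open import Data.Integer using (ℤ; +_; 0ℤ) renaming (_+_ to _+ℤ_; _*_ to _*ℤ_)
open import Data.List using (List; []; _∷_)
open import Data.Bool using (Bool; true; false)
open import Data.Product using (_×_; _,_; ∃)
open import Relation.Binary.PropositionalEquality using (_≡_)
open import Relation.Nullary using (¬_)

-- Polynomials ℤ[z] as coefficient lists (constant term first).

Poly : Set
Poly = List ℤ

coeff : Poly → ℕ → ℤ
coeff []       _       = 0ℤ
coeff (a ∷ p)  zero    = a
coeff (a ∷ p)  (suc k) = coeff p k

-- equality of polynomials (coefficientwise; insensitive to trailing zeros)
_≈ₚ_ : Poly → Poly → Set
p ≈ₚ q = ∀ k → coeff p k ≡ coeff q k

NonZeroPoly : Poly → Set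
NonZeroPoly p = ∃ λ k → ¬ (coeff p k ≡ 0ℤ)

_+ₚ_ : Poly → Poly → Poly
[]      +ₚ q       = q
(a ∷ p) +ₚ []      = a ∷ p
(a ∷ p) +ₚ (b ∷ q) = (a +ℤ b) ∷ (p +ₚ q)

scale : ℤ → Poly → Poly
scale c []      = []
scale c (a ∷ p) = (c *ℤ a) ∷ scale c p

_*ₚ_ : Poly → Poly → Poly
[]      *ₚ q = []
(a ∷ p) *ₚ q = scale a q +ₚ (0ℤ ∷ (p *ₚ q))

constP : ℤ → Poly
constP c = c ∷ []

-- Elements of ℚ(z) = Frac(ℤ[z]) as formal fractions num / den.

record RatFun : Set where
  constructor _⁄_
  field
    num : Poly
    den : Poly
open RatFun public

_≈_ : RatFun → RatFun → Set
(p ⁄ q) ≈ (p' ⁄ q') = (p *ₚ q') ≈ₚ (p' *ₚ q)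

_·_ : RatFun → RatFun → RatFun
(p ⁄ q) · (p' ⁄ q') = (p *ₚ p') ⁄ (q *ₚ q')

zRF : RatFun
zRF = (0ℤ ∷ + 1 ∷ []) ⁄ constP (+ 1)

constRF : ℕ → ℕ → RatFun
constRF a b = constP (+ a) ⁄ constP (+ b)

invRoot : ℕ → ℕ → RatFun
invRoot u v = constP (+ v) ⁄ (0ℤ ∷ + u ∷ [])

-- left child  w ↦ w / (u w + 1)  :  p/q ↦ p / (u p + q)
leftChild : ℕ → RatFun → RatFun
leftChild u (p ⁄ q) = p ⁄ (scale (+ u) p +ₚ q)

-- right child w ↦ w + v  :  p/q ↦ (p + v q) / q
rightChild : ℕ → RatFun → RatFun
rightChild v (p ⁄ q) = (p +ₚ scale (+ v) q) ⁄ q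

isOdd : ℕ → Bool
isOdd zero          = false
isOdd (suc zero)    = true
isOdd (suc (suc n)) = isOdd n

-- node u v r n j : the vertex of row n with 0-based index j
-- (children of 0-based vertex k are 2k and 2k+1)
node : ℕ → ℕ → RatFun → ℕ → ℕ → RatFun
node u v r zero    j = r
node u v r (suc n) j with isOdd j
... | false = leftChild  u (node u v r n ⌊ j /2⌋)
... | true  = rightChild v (node u v r n ⌊ j /2⌋)

-- c_r^{(u,v)}(n,i), i-th vertex (1-based) of row n
c : ℕ → ℕ → RatFun → ℕ → ℕ → RatFun
c u v r n i = node u v r n (Data.Nat._∸_ i 1)

module Submission where

-- Write L w = w / (u w + 1) and R w = w + v. If a · b = v/u then also
-- L a · R b = v/u and R a · L b = v/u, since (a b + v a) u = v (u a + 1) exactly when a b u = v.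
-- In row n + 1 the mirror image of a left child is the right child of the mirror image of its
-- parent (and vice versa), so induction on the rows starting from z · v/(u z) = v/u gives the
-- product formula. Denominators stay nonzero because every vertex has nonnegative coefficients:
-- the denominator u p + q of a left child cannot cancel.

open import Data.Bool using (true; false)
open import Data.Empty using (⊥-elim)
open import Data.Integer using (ℤ; +_; 0ℤ; 1ℤ) renaming (_+_ to _+ℤ_; _*_ to _*ℤ_)
open import Data.Integer.Properties using (+-identityʳ; +-identityˡ; *-identityˡ; *-zeroʳ; pos-*)
open import Data.Integer.Tactic.RingSolver using (solve-∀)
open import Data.List using ([]; _∷_; drop)
open import Data.List.Relation.Unary.All using (All; []; _∷_)
open import Data.List.Relation.Unary.Any using (Any; here; there)
open import Data.Nat using (ℕ; zero; suc; _≤_; _^_; _+_; _*_; _∸_; s≤s; z≤n; ⌊_/2⌋)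
open import Data.Nat.Properties
  using (+-comm; +-suc; *-suc; *-cancelˡ-≡; even≢odd; ∸-+-assoc; m+[n∸m]≡n)
import Data.Nat.Tactic.RingSolver as ℕ-Solver
open import Data.Product using (_×_; ∃; _,_)
open import Relation.Binary.PropositionalEquality
  using (_≡_; refl; sym; trans; cong; cong₂; subst; module ≡-Reasoning)
open ≡-Reasoning

open import Defs

coeff-+ₚ : ∀ p q k → coeff (p +ₚ q) k ≡ coeff p k +ℤ coeff q k
coeff-+ₚ []      q       k       = sym (+-identityˡ _)
coeff-+ₚ (a ∷ p) []      k       = sym (+-identityʳ _)
coeff-+ₚ (a ∷ p) (b ∷ q) zero    = refl
coeff-+ₚ (a ∷ p) (b ∷ q) (suc k) = coeff-+ₚ p q k

coeff-scale : ∀ c p k → coeff (scale c p) k ≡ c *ℤ coeff p k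
coeff-scale c []      k       = sym (*-zeroʳ c)
coeff-scale c (a ∷ p) zero    = refl
coeff-scale c (a ∷ p) (suc k) = coeff-scale c p k

coeff-drop-1 : ∀ p k → coeff (drop 1 p) k ≡ coeff p (suc k)
coeff-drop-1 []      k = refl
coeff-drop-1 (a ∷ p) k = refl

coeff-*ₚ-zero : ∀ p q → coeff (p *ₚ q) 0 ≡ coeff p 0 *ℤ coeff q 0
coeff-*ₚ-zero []      q = refl
coeff-*ₚ-zero (a ∷ p) q =
  trans (coeff-+ₚ (scale a q) _ 0) (trans (+-identityʳ _) (coeff-scale a q 0))

coeff-*ₚ-suc : ∀ p q k →
  coeff (p *ₚ q) (suc k) ≡ coeff p 0 *ℤ coeff q (suc k) +ℤ coeff (drop 1 p *ₚ q) k
coeff-*ₚ-suc []      q k = refl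
coeff-*ₚ-suc (a ∷ p) q k =
  trans (coeff-+ₚ (scale a q) _ (suc k)) (cong (_+ℤ coeff (p *ₚ q) k) (coeff-scale a q (suc k)))

coeff-*ₚ-constP : ∀ p c k → coeff (p *ₚ constP c) k ≡ coeff p k *ℤ c
coeff-*ₚ-constP p c zero    = coeff-*ₚ-zero p (constP c)
coeff-*ₚ-constP p c (suc k) = begin
  coeff (p *ₚ constP c) (suc k)
    ≡⟨ coeff-*ₚ-suc p (constP c) k ⟩
  coeff p 0 *ℤ 0ℤ +ℤ coeff (drop 1 p *ₚ constP c) k
    ≡⟨ cong₂ _+ℤ_ (*-zeroʳ (coeff p 0)) (coeff-*ₚ-constP (drop 1 p) c k) ⟩
  0ℤ +ℤ coeff (drop 1 p) k *ℤ c
    ≡⟨ +-identityˡ _ ⟩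
  coeff (drop 1 p) k *ℤ c
    ≡⟨ cong (_*ℤ c) (coeff-drop-1 p k) ⟩
  coeff p (suc k) *ℤ c ∎

coeff-constP-*ₚ : ∀ c q k → coeff (constP c *ₚ q) k ≡ c *ℤ coeff q k
coeff-constP-*ₚ c q zero    = coeff-*ₚ-zero (constP c) q
coeff-constP-*ₚ c q (suc k) = trans (coeff-*ₚ-suc (constP c) q k) (+-identityʳ _)

-- A record rather than a plain Π-type so that x, y and z can be inferred from it.
record LinComb (α : ℤ) (x : Poly) (β : ℤ) (y z : Poly) : Set where
  field coeff-lincomb : ∀ k → coeff z k ≡ α *ℤ coeff x k +ℤ β *ℤ coeff y k
open LinComb

+ₚ-scale-LinComb : ∀ β x y → LinComb 1ℤ x β y (x +ₚ scale β y)
coeff-lincomb (+ₚ-scale-LinComb β x y) k =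
  trans (coeff-+ₚ x (scale β y) k)
        (cong₂ _+ℤ_ (sym (*-identityˡ (coeff x k))) (coeff-scale β y k))

scale-+ₚ-LinComb : ∀ α x y → LinComb α x 1ℤ y (scale α x +ₚ y)
coeff-lincomb (scale-+ₚ-LinComb α x y) k =
  trans (coeff-+ₚ (scale α x) y k)
        (cong₂ _+ℤ_ (coeff-scale α x k) (sym (*-identityˡ (coeff y k))))

LinComb-drop-1 : ∀ {α x β y z} → LinComb α x β y z →
                 LinComb α (drop 1 x) β (drop 1 y) (drop 1 z)
coeff-lincomb (LinComb-drop-1 {α} {x} {β} {y} {z} h) k = begin
  coeff (drop 1 z) k                           ≡⟨ coeff-drop-1 z k ⟩
  coeff z (suc k)                              ≡⟨ coeff-lincomb h (suc k) ⟩
  α *ℤ coeff x (suc k) +ℤ β *ℤ coeff y (suc k)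
    ≡⟨ cong₂ (λ s t → α *ℤ s +ℤ β *ℤ t) (coeff-drop-1 x k) (coeff-drop-1 y k) ⟨
  α *ℤ coeff (drop 1 x) k +ℤ β *ℤ coeff (drop 1 y) k ∎

private
  *-comb : ∀ α β c x y → c *ℤ (α *ℤ x +ℤ β *ℤ y) ≡ α *ℤ (c *ℤ x) +ℤ β *ℤ (c *ℤ y)
  *-comb = solve-∀
  comb-* : ∀ α β c x y → (α *ℤ x +ℤ β *ℤ y) *ℤ c ≡ α *ℤ (x *ℤ c) +ℤ β *ℤ (y *ℤ c)
  comb-* = solve-∀
  *-+-comb : ∀ α β c x y x′ y′ → c *ℤ (α *ℤ x +ℤ β *ℤ y) +ℤ (α *ℤ x′ +ℤ β *ℤ y′)
                                  ≡ α *ℤ (c *ℤ x +ℤ x′) +ℤ β *ℤ (c *ℤ y +ℤ y′)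
  *-+-comb = solve-∀
  comb-*-+ : ∀ α β c x y x′ y′ → (α *ℤ x +ℤ β *ℤ y) *ℤ c +ℤ (α *ℤ x′ +ℤ β *ℤ y′)
                                  ≡ α *ℤ (x *ℤ c +ℤ x′) +ℤ β *ℤ (y *ℤ c +ℤ y′)
  comb-*-+ = solve-∀

module _ {α β : ℤ} where

  private
    comb : ℤ → ℤ → ℤ
    comb s t = α *ℤ s +ℤ β *ℤ t

  LinComb-*ₚˡ : ∀ {x y z} → LinComb α x β y z → ∀ p →
                LinComb α (p *ₚ x) β (p *ₚ y) (p *ₚ z)
  coeff-lincomb (LinComb-*ₚˡ {x} {y} {z} h p) zero = begin
    coeff (p *ₚ z) 0               ≡⟨ coeff-*ₚ-zero p z ⟩
    a *ℤ coeff z 0                 ≡⟨ cong (a *ℤ_) (coeff-lincomb h 0) ⟩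
    a *ℤ comb x₀ y₀                ≡⟨ *-comb α β a x₀ y₀ ⟩
    comb (a *ℤ x₀) (a *ℤ y₀)       ≡⟨ cong₂ comb (coeff-*ₚ-zero p x) (coeff-*ₚ-zero p y) ⟨
    comb (coeff (p *ₚ x) 0) (coeff (p *ₚ y) 0) ∎
    where a = coeff p 0; x₀ = coeff x 0; y₀ = coeff y 0
  coeff-lincomb (LinComb-*ₚˡ {x} {y} {z} h p) (suc k) = begin
    coeff (p *ₚ z) (suc k)
      ≡⟨ coeff-*ₚ-suc p z k ⟩
    a *ℤ coeff z (suc k) +ℤ coeff (drop 1 p *ₚ z) k
      ≡⟨ cong₂ _+ℤ_ (cong (a *ℤ_) (coeff-lincomb h (suc k)))
                    (coeff-lincomb (LinComb-*ₚˡ h (drop 1 p)) k) ⟩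
    a *ℤ comb x₁ y₁ +ℤ comb X Y
      ≡⟨ *-+-comb α β a x₁ y₁ X Y ⟩
    comb (a *ℤ x₁ +ℤ X) (a *ℤ y₁ +ℤ Y)
      ≡⟨ cong₂ comb (coeff-*ₚ-suc p x k) (coeff-*ₚ-suc p y k) ⟨
    comb (coeff (p *ₚ x) (suc k)) (coeff (p *ₚ y) (suc k)) ∎
    where
    a = coeff p 0; x₁ = coeff x (suc k); y₁ = coeff y (suc k)
    X = coeff (drop 1 p *ₚ x) k; Y = coeff (drop 1 p *ₚ y) k

  LinComb-*ₚʳ : ∀ {x y z} → LinComb α x β y z → ∀ q →
                LinComb α (x *ₚ q) β (y *ₚ q) (z *ₚ q)
  coeff-lincomb (LinComb-*ₚʳ {x} {y} {z} h q) zero = begin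
    coeff (z *ₚ q) 0               ≡⟨ coeff-*ₚ-zero z q ⟩
    coeff z 0 *ℤ b                 ≡⟨ cong (_*ℤ b) (coeff-lincomb h 0) ⟩
    comb x₀ y₀ *ℤ b                ≡⟨ comb-* α β b x₀ y₀ ⟩
    comb (x₀ *ℤ b) (y₀ *ℤ b)       ≡⟨ cong₂ comb (coeff-*ₚ-zero x q) (coeff-*ₚ-zero y q) ⟨
    comb (coeff (x *ₚ q) 0) (coeff (y *ₚ q) 0) ∎
    where b = coeff q 0; x₀ = coeff x 0; y₀ = coeff y 0
  coeff-lincomb (LinComb-*ₚʳ {x} {y} {z} h q) (suc k) = begin
    coeff (z *ₚ q) (suc k)
      ≡⟨ coeff-*ₚ-suc z q k ⟩
    coeff z 0 *ℤ b +ℤ coeff (drop 1 z *ₚ q) k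
      ≡⟨ cong₂ _+ℤ_ (cong (_*ℤ b) (coeff-lincomb h 0))
                    (coeff-lincomb (LinComb-*ₚʳ (LinComb-drop-1 h) q) k) ⟩
    comb x₀ y₀ *ℤ b +ℤ comb X Y
      ≡⟨ comb-*-+ α β b x₀ y₀ X Y ⟩
    comb (x₀ *ℤ b +ℤ X) (y₀ *ℤ b +ℤ Y)
      ≡⟨ cong₂ comb (coeff-*ₚ-suc x q k) (coeff-*ₚ-suc y q k) ⟨
    comb (coeff (x *ₚ q) (suc k)) (coeff (y *ₚ q) (suc k)) ∎
    where
    b = coeff q (suc k); x₀ = coeff x 0; y₀ = coeff y 0
    X = coeff (drop 1 x *ₚ q) k; Y = coeff (drop 1 y *ₚ q) k

private
  reciprocal-step : ∀ U V A B C → A *ℤ U ≡ V *ℤ C →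
    (1ℤ *ℤ A +ℤ V *ℤ B) *ℤ U ≡ V *ℤ (U *ℤ B +ℤ 1ℤ *ℤ C)
  reciprocal-step U V A B C e = begin
    (1ℤ *ℤ A +ℤ V *ℤ B) *ℤ U   ≡⟨ expand U V A B ⟩
    A *ℤ U +ℤ V *ℤ (U *ℤ B)     ≡⟨ cong (_+ℤ V *ℤ (U *ℤ B)) e ⟩
    V *ℤ C +ℤ V *ℤ (U *ℤ B)     ≡⟨ collect U V B C ⟩
    V *ℤ (U *ℤ B +ℤ 1ℤ *ℤ C)   ∎
    where
    expand : ∀ U V A B → (1ℤ *ℤ A +ℤ V *ℤ B) *ℤ U ≡ A *ℤ U +ℤ V *ℤ (U *ℤ B)
    expand = solve-∀
    collect : ∀ U V B C → V *ℤ C +ℤ V *ℤ (U *ℤ B) ≡ V *ℤ (U *ℤ B +ℤ 1ℤ *ℤ C)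
    collect = solve-∀

module _ {u v : ℕ} where

  private
    U V : ℤ
    U = + u
    V = + v

  coeff⇒≈-constRF : ∀ x y → (∀ k → coeff x k *ℤ U ≡ V *ℤ coeff y k) → (x ⁄ y) ≈ constRF v u
  coeff⇒≈-constRF x y h k =
    trans (coeff-*ₚ-constP x U k) (trans (h k) (sym (coeff-constP-*ₚ V y k)))

  ≈-constRF⇒coeff : ∀ x y → (x ⁄ y) ≈ constRF v u → ∀ k → coeff x k *ℤ U ≡ V *ℤ coeff y k
  ≈-constRF⇒coeff x y h k =
    trans (sym (coeff-*ₚ-constP x U k)) (trans (h k) (coeff-constP-*ₚ V y k))

  leftChild·rightChild : ∀ a b → (a · b) ≈ constRF v u →
                         (leftChild u a · rightChild v b) ≈ constRF v u
  leftChild·rightChild (p ⁄ q) (p′ ⁄ q′) h =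
    coeff⇒≈-constRF (p *ₚ (p′ +ₚ scale V q′)) ((scale U p +ₚ q) *ₚ q′) λ k → begin
      coeff (p *ₚ (p′ +ₚ scale V q′)) k *ℤ U
        ≡⟨ cong (_*ℤ U) (coeff-lincomb (LinComb-*ₚˡ (+ₚ-scale-LinComb V p′ q′) p) k) ⟩
      (1ℤ *ℤ coeff (p *ₚ p′) k +ℤ V *ℤ coeff (p *ₚ q′) k) *ℤ U
        ≡⟨ reciprocal-step U V (coeff (p *ₚ p′) k) (coeff (p *ₚ q′) k) (coeff (q *ₚ q′) k)
             (≈-constRF⇒coeff (p *ₚ p′) (q *ₚ q′) h k) ⟩
      V *ℤ (U *ℤ coeff (p *ₚ q′) k +ℤ 1ℤ *ℤ coeff (q *ₚ q′) k)
        ≡⟨ cong (V *ℤ_) (coeff-lincomb (LinComb-*ₚʳ (scale-+ₚ-LinComb U p q) q′) k) ⟨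
      V *ℤ coeff ((scale U p +ₚ q) *ₚ q′) k ∎

  rightChild·leftChild : ∀ a b → (a · b) ≈ constRF v u →
                         (rightChild v a · leftChild u b) ≈ constRF v u
  rightChild·leftChild (p ⁄ q) (p′ ⁄ q′) h =
    coeff⇒≈-constRF ((p +ₚ scale V q) *ₚ p′) (q *ₚ (scale U p′ +ₚ q′)) λ k → begin
      coeff ((p +ₚ scale V q) *ₚ p′) k *ℤ U
        ≡⟨ cong (_*ℤ U) (coeff-lincomb (LinComb-*ₚʳ (+ₚ-scale-LinComb V p q) p′) k) ⟩
      (1ℤ *ℤ coeff (p *ₚ p′) k +ℤ V *ℤ coeff (q *ₚ p′) k) *ℤ U
        ≡⟨ reciprocal-step U V (coeff (p *ₚ p′) k) (coeff (q *ₚ p′) k) (coeff (q *ₚ q′) k)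
             (≈-constRF⇒coeff (p *ₚ p′) (q *ₚ q′) h k) ⟩
      V *ℤ (U *ℤ coeff (q *ₚ p′) k +ℤ 1ℤ *ℤ coeff (q *ₚ q′) k)
        ≡⟨ cong (V *ℤ_) (coeff-lincomb (LinComb-*ₚˡ (scale-+ₚ-LinComb U p′ q′) q) k) ⟨
      V *ℤ coeff (q *ₚ (scale U p′ +ₚ q′)) k ∎

  zRF·invRoot : (zRF · invRoot u v) ≈ constRF v u
  zRF·invRoot = coeff⇒≈-constRF (z *ₚ constP V) (constP 1ℤ *ₚ uz) λ k → begin
    coeff (z *ₚ constP V) k *ℤ U    ≡⟨ cong (_*ℤ U) (coeff-*ₚ-constP z V k) ⟩
    coeff z k *ℤ V *ℤ U             ≡⟨ coeffs k ⟩
    V *ℤ (1ℤ *ℤ coeff uz k)         ≡⟨ cong (V *ℤ_) (coeff-constP-*ₚ 1ℤ uz k) ⟨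
    V *ℤ coeff (constP 1ℤ *ₚ uz) k  ∎
    where
    z uz : Poly
    z  = 0ℤ ∷ 1ℤ ∷ []
    uz = 0ℤ ∷ U ∷ []
    1-comm : ∀ U V → 1ℤ *ℤ V *ℤ U ≡ V *ℤ (1ℤ *ℤ U)
    1-comm = solve-∀
    coeffs : ∀ k → coeff z k *ℤ V *ℤ U ≡ V *ℤ (1ℤ *ℤ coeff uz k)
    coeffs zero          = sym (*-zeroʳ V)
    coeffs (suc zero)    = 1-comm U V
    coeffs (suc (suc k)) = sym (*-zeroʳ V)

data ParityView : ℕ → Set where
  even : ∀ k → ParityView (2 * k)
  odd  : ∀ k → ParityView (1 + 2 * k)

parityView : ∀ j → ParityView j
parityView zero = even 0
parityView (suc j) with parityView j
... | even k = odd k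
... | odd k  = subst ParityView (*-suc 2 k) (even (suc k))

isOdd-2* : ∀ k → isOdd (2 * k) ≡ false
isOdd-2* zero    = refl
isOdd-2* (suc k) = trans (cong isOdd (*-suc 2 k)) (isOdd-2* k)

isOdd-1+2* : ∀ k → isOdd (1 + 2 * k) ≡ true
isOdd-1+2* zero    = refl
isOdd-1+2* (suc k) = trans (cong (λ t → isOdd (suc t)) (*-suc 2 k)) (isOdd-1+2* k)

⌊2*n/2⌋≡n : ∀ n → ⌊ 2 * n /2⌋ ≡ n
⌊2*n/2⌋≡n zero    = refl
⌊2*n/2⌋≡n (suc n) = trans (cong ⌊_/2⌋ (*-suc 2 n)) (cong suc (⌊2*n/2⌋≡n n))

⌊1+2*n/2⌋≡n : ∀ n → ⌊ 1 + 2 * n /2⌋ ≡ n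
⌊1+2*n/2⌋≡n zero    = refl
⌊1+2*n/2⌋≡n (suc n) =
  trans (cong (λ t → ⌊ suc t /2⌋) (*-suc 2 n)) (cong suc (⌊1+2*n/2⌋≡n n))

node-2* : ∀ u v r n k → node u v r (suc n) (2 * k) ≡ leftChild u (node u v r n k)
node-2* u v r n k rewrite isOdd-2* k | ⌊2*n/2⌋≡n k = refl

node-1+2* : ∀ u v r n k → node u v r (suc n) (1 + 2 * k) ≡ rightChild v (node u v r n k)
node-1+2* u v r n k rewrite isOdd-1+2* k | ⌊1+2*n/2⌋≡n k = refl

-- In row n the 0-based index j is mirrored to 2 ^ n ∸ 1 ∸ j; the relation is stated as
-- j + m + 1 ≡ 2 ^ n to avoid truncated subtraction.
data MirrorChildren (n : ℕ) : ℕ → ℕ → Set where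
  left-right : ∀ {k l} → k + l + 1 ≡ 2 ^ n → MirrorChildren n (2 * k) (1 + 2 * l)
  right-left : ∀ {k l} → k + l + 1 ≡ 2 ^ n → MirrorChildren n (1 + 2 * k) (2 * l)

mirror-children : ∀ n j m → j + m + 1 ≡ 2 ^ suc n → MirrorChildren n j m
mirror-children n j m e with parityView j | parityView m
... | even k | even l = ⊥-elim (even≢odd (2 ^ n) (k + l) (sym (trans (even-even k l) e)))
  where
  even-even : ∀ k l → 1 + 2 * (k + l) ≡ 2 * k + 2 * l + 1
  even-even = ℕ-Solver.solve-∀
... | odd k  | odd l  = ⊥-elim (even≢odd (2 ^ n) (k + l + 1) (sym (trans (odd-odd k l) e)))
  where
  odd-odd : ∀ k l → 1 + 2 * (k + l + 1) ≡ (1 + 2 * k) + (1 + 2 * l) + 1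
  odd-odd = ℕ-Solver.solve-∀
... | even k | odd l  =
  left-right {k = k} {l = l} (*-cancelˡ-≡ (k + l + 1) (2 ^ n) 2 (trans (even-odd k l) e))
  where
  even-odd : ∀ k l → 2 * (k + l + 1) ≡ 2 * k + (1 + 2 * l) + 1
  even-odd = ℕ-Solver.solve-∀
... | odd k  | even l =
  right-left {k = k} {l = l} (*-cancelˡ-≡ (k + l + 1) (2 ^ n) 2 (trans (odd-even k l) e))
  where
  odd-even : ∀ k l → 2 * (k + l + 1) ≡ (1 + 2 * k) + 2 * l + 1
  odd-even = ℕ-Solver.solve-∀

module _ {u v : ℕ} {r s : RatFun} (r·s : (r · s) ≈ constRF v u) where

  mirror-product : ∀ n j m → j + m + 1 ≡ 2 ^ n →
                   (node u v r n j · node u v s n m) ≈ constRF v u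
  mirror-product zero    j m _ = r·s
  mirror-product (suc n) j m e with mirror-children n j m e
  ... | left-right {k} {l} e′ rewrite node-2* u v r n k | node-1+2* u v s n l =
    leftChild·rightChild (node u v r n k) (node u v s n l) (mirror-product n k l e′)
  ... | right-left {k} {l} e′ rewrite node-1+2* u v r n k | node-2* u v s n l =
    rightChild·leftChild (node u v r n k) (node u v s n l) (mirror-product n k l e′)

NonNeg Pos : ℤ → Set
NonNeg a = ∃ λ n → a ≡ + n
Pos    a = ∃ λ n → a ≡ + suc n

All-NonNeg-+ₚ : ∀ {p q} → All NonNeg p → All NonNeg q → All NonNeg (p +ₚ q)
All-NonNeg-+ₚ []                 nq                 = nq
All-NonNeg-+ₚ (np₀ ∷ np)          []                 = np₀ ∷ np
All-NonNeg-+ₚ ((m , refl) ∷ np)  ((n , refl) ∷ nq)  = (m + n , refl) ∷ All-NonNeg-+ₚ np nq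

All-NonNeg-scale : ∀ c {p} → All NonNeg p → All NonNeg (scale (+ c) p)
All-NonNeg-scale c []                = []
All-NonNeg-scale c ((n , refl) ∷ np) = (c * n , sym (pos-* c n)) ∷ All-NonNeg-scale c np

Any-Pos-+ₚ : ∀ {p q} → All NonNeg p → Any Pos q → Any Pos (p +ₚ q)
Any-Pos-+ₚ []                 pq                = pq
Any-Pos-+ₚ ((m , refl) ∷ np)  (here (n , refl)) = here (m + n , cong +_ (+-suc m n))
Any-Pos-+ₚ (_ ∷ np)           (there pq)        = there (Any-Pos-+ₚ np pq)

Any-Pos⇒NonZeroPoly : ∀ {p} → Any Pos p → NonZeroPoly p
Any-Pos⇒NonZeroPoly (here (n , refl)) = 0 , λ ()
Any-Pos⇒NonZeroPoly (there pp) with k , coeff≢0 ← Any-Pos⇒NonZeroPoly pp = suc k , coeff≢0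

record PositiveRatFun (w : RatFun) : Set where
  field
    num-nonNeg : All NonNeg (num w)
    den-nonNeg : All NonNeg (den w)
    den-pos    : Any Pos (den w)
open PositiveRatFun

module _ {u v : ℕ} where

  leftChild-positive : ∀ {w} → PositiveRatFun w → PositiveRatFun (leftChild u w)
  leftChild-positive {p ⁄ q} pw = record
    { num-nonNeg = num-nonNeg pw
    ; den-nonNeg = All-NonNeg-+ₚ (All-NonNeg-scale u (num-nonNeg pw)) (den-nonNeg pw)
    ; den-pos    = Any-Pos-+ₚ (All-NonNeg-scale u (num-nonNeg pw)) (den-pos pw)
    }

  rightChild-positive : ∀ {w} → PositiveRatFun w → PositiveRatFun (rightChild v w)
  rightChild-positive {p ⁄ q} pw = record
    { num-nonNeg = All-NonNeg-+ₚ (num-nonNeg pw) (All-NonNeg-scale v (den-nonNeg pw))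
    ; den-nonNeg = den-nonNeg pw
    ; den-pos    = den-pos pw
    }

  node-positive : ∀ {r} → PositiveRatFun r → ∀ n j → PositiveRatFun (node u v r n j)
  node-positive pr zero    j = pr
  node-positive pr (suc n) j with isOdd j
  ... | false = leftChild-positive (node-positive pr n ⌊ j /2⌋)
  ... | true  = rightChild-positive (node-positive pr n ⌊ j /2⌋)

zRF-positive : PositiveRatFun zRF
zRF-positive = record
  { num-nonNeg = (0 , refl) ∷ (1 , refl) ∷ []
  ; den-nonNeg = (1 , refl) ∷ []
  ; den-pos    = here (0 , refl)
  }

invRoot-positive : ∀ {u v} → 1 ≤ u → PositiveRatFun (invRoot u v)
invRoot-positive {suc u} {v} _ = record
  { num-nonNeg = (v , refl) ∷ []
  ; den-nonNeg = (0 , refl) ∷ (suc u , refl) ∷ []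
  ; den-pos    = there (here (u , refl))
  }

mirror-index : ∀ {N i} → 1 ≤ i → i ≤ N → (i ∸ 1) + (N + 1 ∸ i ∸ 1) + 1 ≡ N
mirror-index {N} {suc i} (s≤s z≤n) i<N = begin
  i + (N + 1 ∸ suc i ∸ 1) + 1  ≡⟨ cong (λ t → i + (t ∸ suc i ∸ 1) + 1) (+-comm N 1) ⟩
  i + (N ∸ i ∸ 1) + 1          ≡⟨ cong (λ t → i + t + 1) (∸-+-assoc N i 1) ⟩
  i + (N ∸ (i + 1)) + 1        ≡⟨ +-comm (i + (N ∸ (i + 1))) 1 ⟩
  suc i + (N ∸ (i + 1))        ≡⟨ cong (λ t → suc i + (N ∸ t)) (+-comm i 1) ⟩
  suc i + (N ∸ suc i)          ≡⟨ m+[n∸m]≡n i<N ⟩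
  N                            ∎

corollary4p4 : (u v : ℕ) → 1 ≤ u → 1 ≤ v → (n i : ℕ) → 1 ≤ i → i ≤ 2 ^ n →
    NonZeroPoly (den (c u v zRF n i))
    × NonZeroPoly (den (c u v (invRoot u v) n ((2 ^ n + 1) ∸ i)))
    × ((c u v zRF n i · c u v (invRoot u v) n ((2 ^ n + 1) ∸ i)) ≈ constRF v u)
corollary4p4 u v 1≤u _ n i 1≤i i≤2ⁿ =
    Any-Pos⇒NonZeroPoly (den-pos (node-positive zRF-positive n (i ∸ 1)))
  , Any-Pos⇒NonZeroPoly (den-pos (node-positive (invRoot-positive 1≤u) n (2 ^ n + 1 ∸ i ∸ 1)))
  , mirror-product (zRF·invRoot {u} {v}) n (i ∸ 1) (2 ^ n + 1 ∸ i ∸ 1) (mirror-index 1≤i i≤2ⁿ)
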